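{- Let $K$ be a field and $X$ a non-empty finite set. There is a countable associative algebra (ring) $B$ which is not residually nilpotent and is elementarily equivalent to $\mathbb{A}^0_K(X)$.
   Context: $\mathbb{A}^0_K(X)$ denotes the free associative algebra without unity over $K$ with basis $X$, viewed in the language of rings $\{+,\cdot,0\}$. For a ring $A$, $A^n$ is the additive subgroup generated by all products $a_1\cdots a_n$, $a_i\in A$; $A$ is residually nilpotent if $\bigcap_{n\ge1}A^n=0$. -}

module Defs where

open import Level using (Level; _⊔_) renaming (suc to lsuc)
open import Algebra.Bundles using (CommutativeRing; RingWithoutOne)
open import Data.Nat using (ℕ; zero; suc; _≥_)
open import Data.Fin using (Fin) renaming (zero to fzero; suc to fsuc)
import Data.Fin as Fin
open import Data.List using (List; []; _∷_; _++_; map; concatMap; length)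
open import Relation.Binary.PropositionalEquality using (_≡_)
open import Data.List.NonEmpty using (List⁺; _⁺++⁺_; toList)
import Data.List.Properties as ListP
open import Data.Product using (Σ; _×_; _,_; ∃)
open import Data.Sum using (_⊎_)
open import Data.Empty using (⊥)
open import Data.Unit using (⊤)
open import Relation.Nullary using (¬_; Dec; yes; no)
open import Relation.Binary.Core using (Rel)

record Field (c ℓ : Level) : Set (lsuc (c ⊔ ℓ)) where
  field
    commutativeRing : CommutativeRing c ℓ
  open CommutativeRing commutativeRing public
  field
    0≉1     : ¬ (0# ≈ 1#)
    inverse : ∀ x → ¬ (x ≈ 0#) → ∃ λ y → (x * y) ≈ 1#

-- Structures for the language of rings {+, ·, 0} (equality is a setoid
-- equality, interpreting the logical symbol =).

record RingLangStructure (c ℓ : Level) : Set (lsuc (c ⊔ ℓ)) where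
  field
    Carrier : Set c
    _≈_     : Rel Carrier ℓ
    _+_     : Carrier → Carrier → Carrier
    _*_     : Carrier → Carrier → Carrier
    0#      : Carrier

reduct : ∀ {c ℓ} → RingWithoutOne c ℓ → RingLangStructure c ℓ
reduct R = record
  { Carrier = R.Carrier ; _≈_ = R._≈_ ; _+_ = R._+_ ; _*_ = R._*_ ; 0# = R.0# }
  where module R = RingWithoutOne R

-- First-order terms and formulas of the language of rings, with
-- variables as de Bruijn indices in Fin n.

data Term (n : ℕ) : Set where
  var  : Fin n → Term n
  zer  : Term n
  _⊕_  : Term n → Term n → Term n
  _⊗_  : Term n → Term n → Term n

data Formula : ℕ → Set where
  _≐_   : ∀ {n} → Term n → Term n → Formula n
  fls   : ∀ {n} → Formula n
  tru   : ∀ {n} → Formula n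
  _∧'_  : ∀ {n} → Formula n → Formula n → Formula n
  _∨'_  : ∀ {n} → Formula n → Formula n → Formula n
  _⇒'_  : ∀ {n} → Formula n → Formula n → Formula n
  ¬'_   : ∀ {n} → Formula n → Formula n
  ∀'_   : ∀ {n} → Formula (suc n) → Formula n
  ∃'_   : ∀ {n} → Formula (suc n) → Formula n

Sentence : Set
Sentence = Formula 0

module _ {c ℓ} (M : RingLangStructure c ℓ) where
  open RingLangStructure M

  ⟦_⟧t : ∀ {n} → Term n → (Fin n → Carrier) → Carrier
  ⟦ var i ⟧t ρ = ρ i
  ⟦ zer ⟧t ρ = 0#
  ⟦ s ⊕ t ⟧t ρ = ⟦ s ⟧t ρ + ⟦ t ⟧t ρ
  ⟦ s ⊗ t ⟧t ρ = ⟦ s ⟧t ρ * ⟦ t ⟧t ρ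

  extend : ∀ {n} → Carrier → (Fin n → Carrier) → Fin (suc n) → Carrier
  extend a ρ fzero = a
  extend a ρ (fsuc i) = ρ i

  -- Tarskian satisfaction (classical once excluded middle is assumed).
  Sat : ∀ {n} → Formula n → (Fin n → Carrier) → Set (c ⊔ ℓ)
  Sat (s ≐ t) ρ = Level.Lift c (⟦ s ⟧t ρ ≈ ⟦ t ⟧t ρ)
  Sat fls ρ = Level.Lift (c ⊔ ℓ) ⊥
  Sat tru ρ = Level.Lift (c ⊔ ℓ) ⊤
  Sat (φ ∧' ψ) ρ = Sat φ ρ × Sat ψ ρ
  Sat (φ ∨' ψ) ρ = Sat φ ρ ⊎ Sat ψ ρ
  Sat (φ ⇒' ψ) ρ = Sat φ ρ → Sat ψ ρ
  Sat (¬' φ) ρ = ¬ Sat φ ρ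
  Sat (∀' φ) ρ = (a : Carrier) → Sat φ (extend a ρ)
  Sat (∃' φ) ρ = Σ Carrier λ a → Sat φ (extend a ρ)

  emptyEnv : Fin 0 → Carrier
  emptyEnv ()

  _⊨_ : Sentence → Set (c ⊔ ℓ)
  _⊨_ φ = Sat φ emptyEnv

ElemEquiv : ∀ {c₁ ℓ₁ c₂ ℓ₂} → RingLangStructure c₁ ℓ₁ → RingLangStructure c₂ ℓ₂
          → Set (c₁ ⊔ ℓ₁ ⊔ c₂ ⊔ ℓ₂)
ElemEquiv M N = (φ : Sentence) → (M ⊨ φ → N ⊨ φ) × (N ⊨ φ → M ⊨ φ)

Countable : ∀ {c ℓ} → RingWithoutOne c ℓ → Set (c ⊔ ℓ)
Countable R = Σ (ℕ → Carrier) λ f → ∀ b → Σ ℕ λ k → f k ≈ b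
  where open RingWithoutOne R

module _ {c ℓ} (R : RingWithoutOne c ℓ) where
  open RingWithoutOne R

  -- product a₁ ⋯ aₖ of a non-empty list (right-nested; bracketing is
  -- irrelevant by associativity)
  prod⁺ : Carrier → List Carrier → Carrier
  prod⁺ a [] = a
  prod⁺ a (b ∷ bs) = a * prod⁺ b bs

  data InPow (n : ℕ) : Carrier → Set (c ⊔ ℓ) where
    gen  : ∀ a as → suc (length as) ≡ n
         → InPow n (prod⁺ a as)
    zero∈ : InPow n 0#
    add  : ∀ {x y} → InPow n x → InPow n y → InPow n (x + y)
    neg  : ∀ {x} → InPow n x → InPow n (- x)
    resp : ∀ {x y} → x ≈ y → InPow n x → InPow n y

  ResiduallyNilpotent : Set (c ⊔ ℓ)
  ResiduallyNilpotent = ∀ a → (∀ n → n ≥ 1 → InPow n a) → a ≈ 0#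

-- The free associative algebra without unity A⁰_K(X) over K with basis
-- X = Fin m, as a structure in the language {+,·,0}.
-- Elements: finite formal K-linear combinations of non-empty words over
-- X (lists of (coefficient, word) pairs); two combinations are equal iff
-- every word has the same total coefficient in both.

module FreeAlg {c ℓ} (K : Field c ℓ) (m : ℕ) where
  private module K = Field K

  Word : Set
  Word = List⁺ (Fin m)

  wordEq? : (u v : Word) → Dec (toList u ≡ toList v)
  wordEq? u v = ListP.≡-dec Fin._≟_ (toList u) (toList v)

  Poly : Set c
  Poly = List (K.Carrier × Word)

  coeff : Poly → Word → K.Carrier
  coeff [] w = K.0#
  coeff ((k , u) ∷ p) w with wordEq? u w
  ... | yes _ = k K.+ coeff p w
  ... | no _  = coeff p w

  _≈P_ : Poly → Poly → Set ℓ
  p ≈P q = ∀ w → coeff p w K.≈ coeff q w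

  _+P_ : Poly → Poly → Poly
  _+P_ = _++_

  _*P_ : Poly → Poly → Poly
  p *P q = concatMap (λ { (a , u) → map (λ { (b , v) → (a K.* b , u ⁺++⁺ v) }) q }) p

  structure : RingLangStructure c ℓ
  structure = record
    { Carrier = Poly ; _≈_ = _≈P_ ; _+_ = _+P_ ; _*_ = _*P_ ; 0# = [] }

A⁰ : ∀ {c ℓ} → Field c ℓ → ℕ → RingLangStructure c ℓ
A⁰ K m = FreeAlg.structure K m

-- A free algebra A⁰_K(X) is a ring with a non-nilpotent element x (any generator). For such a ring R
-- consider sequences (aᵢ) in R named by terms built from the constant x, the sequences (x^(i-r+1))ᵢ,
-- the ring operations and Skolem functions (chosen pointwise by excluded middle). There are countably
-- many such terms, hence countably many sets {i | R ⊨ φ(a¹ᵢ, …, aᵏᵢ)}, and a diagonal construction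
-- gives a filter deciding every one of them. Modulo that filter the terms form a ring B for which
-- Łoś's theorem holds, so B ≡ R. The sequence (x^(i+1))ᵢ agrees with x^(n-1)·(x^(i-n+2))ᵢ from index
-- n - 1 on, so it lies in every Bⁿ, but it is not 0 in B because no power of x vanishes.
module Submission where

open import Defs
open import Level using (Level; _⊔_; 0ℓ; lift; lower)
open import Axiom.ExcludedMiddle using (ExcludedMiddle)
open import Algebra.Bundles using (RingWithoutOne)
import Algebra.Properties.AbelianGroup as AbelianGroupProperties
import Algebra.Properties.CommutativeSemigroup as CommutativeSemigroupProperties
open import Data.Nat using (ℕ; zero; suc; _∸_; _≤_; _≥_; _<?_; s≤s) renaming (_+_ to _+ℕ_; _⊔_ to _⊔ℕ_)
import Data.Nat.Properties as ℕ
import Data.Nat.InfinitelyOften as Often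
open import Data.Fin using (Fin; toℕ; fromℕ<) renaming (zero to fzero; suc to fsuc)
import Data.Fin.Properties as Finₚ
open import Data.Vec using (Vec; []; _∷_; lookup; tabulate; replicate)
open import Data.List using (List; []; _∷_; _++_; map; reverse; length)
import Data.List.Properties as List
open import Data.List.NonEmpty using (_∷_; toList; _⁺++⁺_)
open import Data.Product using (Σ; ∃; _×_; _,_; proj₁; proj₂; map₁; uncurry)
open import Data.Sum using (_⊎_; inj₁; inj₂; [_,_])
open import Data.Empty using (⊥-elim)
open import Data.Unit using (⊤)
open import Function using (_∘_; _∘′_; id; _⇔_; mk⇔; Equivalence)
open import Function.Construct.Composition using (_⇔-∘_)
open import Relation.Nullary using (¬_; Dec; yes; no)
open import Relation.Nullary.Decidable using (decidable-stable; True; toWitness)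
open import Relation.Unary using (Pred; _⊆_; _∩_; _∪_; ∁; Empty)
open import Relation.Binary.Definitions using (DecidableEquality)
open import Relation.Binary.Structures using (IsEquivalence)
open import Relation.Binary.PropositionalEquality
  using (_≡_; _≗_; refl; sym; trans; cong; cong₂; subst; subst₂)

open Equivalence using (to; from)

-- pow⁺ _∙_ x k is x^(k+1).
pow⁺ : ∀ {a} {A : Set a} → (A → A → A) → A → ℕ → A
pow⁺ _∙_ x zero    = x
pow⁺ _∙_ x (suc k) = x ∙ pow⁺ _∙_ x k

AtMostOne : ∀ {a p} {A : Set a} → (A → Set p) → Set (a ⊔ p)
AtMostOne P = (∃ λ r → ∀ v → P v ⇔ (v ≡ r)) ⊎ (∀ v → ¬ P v)

module _ {a} {A : Set a} (_≟_ : DecidableEquality A) where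

  ++-solveʳ : ∀ (u w : List A) → AtMostOne (λ v → u ++ v ≡ w)
  ++-solveʳ []      w       = inj₁ (w , λ v → mk⇔ id id)
  ++-solveʳ (x ∷ u) []      = inj₂ (λ v ())
  ++-solveʳ (x ∷ u) (y ∷ w) with x ≟ y | ++-solveʳ u w
  ... | no x≢y   | _            = inj₂ (λ v e → x≢y (List.∷-injectiveˡ e))
  ... | yes refl | inj₁ (r , h) =
    inj₁ (r , λ v → mk⇔ (to (h v) ∘ List.∷-injectiveʳ) (cong (x ∷_) ∘ from (h v)))
  ... | yes refl | inj₂ none    = inj₂ (λ v e → none v (List.∷-injectiveʳ e))

  ++⇔reverse : ∀ (u v w : List A) → (u ++ v ≡ w) ⇔ (reverse v ++ reverse u ≡ reverse w)
  ++⇔reverse u v w = mk⇔ (λ e → trans (sym (List.reverse-++ u v)) (cong reverse e))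
                         (λ e → List.reverse-injective (trans (List.reverse-++ u v) e))

  reverse≡⇔≡reverse : ∀ (u r : List A) → (reverse u ≡ r) ⇔ (u ≡ reverse r)
  reverse≡⇔≡reverse u r = mk⇔ (λ e → trans (sym (List.reverse-involutive u)) (cong reverse e))
                                 (λ e → trans (cong reverse e) (List.reverse-involutive r))

  ++-solveˡ : ∀ (v w : List A) → AtMostOne (λ u → u ++ v ≡ w)
  ++-solveˡ v w with ++-solveʳ (reverse v) (reverse w)
  ... | inj₁ (r , h) = inj₁ (reverse r , λ u →
          reverse≡⇔≡reverse u r ⇔-∘ (h (reverse u) ⇔-∘ ++⇔reverse u v w))
  ... | inj₂ none = inj₂ (λ u → none (reverse u) ∘ to (++⇔reverse u v w))

module FreeRing {c ℓ} (K : Field c ℓ) (m : ℕ) where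
  open FreeAlg K m
  private
    module K = Field K
    module +-AbelianGroup = AbelianGroupProperties K.+-abelianGroup
    module +-CommutativeSemigroup = CommutativeSemigroupProperties K.+-commutativeSemigroup
  open K using (0#; 1#; _≈_)
  open import Relation.Binary.Reasoning.Setoid K.setoid

  _≟ₗ_ : DecidableEquality (List (Fin m))
  _≟ₗ_ = List.≡-dec Data.Fin._≟_

  private variable
    a b : Level
    X Y : Set a

  ∑ : List X → (X → K.Carrier) → K.Carrier
  ∑ []       f = 0#
  ∑ (x ∷ xs) f = f x K.+ ∑ xs f

  ∑-cong : ∀ (xs : List X) {f g : X → K.Carrier} → (∀ x → f x ≈ g x) → ∑ xs f ≈ ∑ xs g
  ∑-cong []       f≈g = K.refl
  ∑-cong (x ∷ xs) f≈g = K.+-cong (f≈g x) (∑-cong xs f≈g)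

  ∑-zero : ∀ (xs : List X) {f : X → K.Carrier} → (∀ x → f x ≈ 0#) → ∑ xs f ≈ 0#
  ∑-zero []       f≈0 = K.refl
  ∑-zero (x ∷ xs) f≈0 = K.trans (K.+-cong (f≈0 x) (∑-zero xs f≈0)) (K.+-identityˡ 0#)

  ∑-++ : ∀ (xs ys : List X) f → ∑ (xs ++ ys) f ≈ ∑ xs f K.+ ∑ ys f
  ∑-++ []       ys f = K.sym (K.+-identityˡ _)
  ∑-++ (x ∷ xs) ys f = K.trans (K.+-cong K.refl (∑-++ xs ys f)) (K.sym (K.+-assoc _ _ _))

  ∑-+ : ∀ (xs : List X) f g → ∑ xs (λ x → f x K.+ g x) ≈ ∑ xs f K.+ ∑ xs g
  ∑-+ []       f g = K.sym (K.+-identityˡ 0#)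
  ∑-+ (x ∷ xs) f g = K.trans (K.+-cong K.refl (∑-+ xs f g)) (+-CommutativeSemigroup.interchange _ _ _ _)

  ∑-*ˡ : ∀ (xs : List X) a f → ∑ xs (λ x → a K.* f x) ≈ a K.* ∑ xs f
  ∑-*ˡ []       a f = K.sym (K.zeroʳ a)
  ∑-*ˡ (x ∷ xs) a f = K.trans (K.+-cong K.refl (∑-*ˡ xs a f)) (K.sym (K.distribˡ _ _ _))

  ∑-*ʳ : ∀ (xs : List X) a f → ∑ xs (λ x → f x K.* a) ≈ ∑ xs f K.* a
  ∑-*ʳ []       a f = K.sym (K.zeroˡ a)
  ∑-*ʳ (x ∷ xs) a f = K.trans (K.+-cong K.refl (∑-*ʳ xs a f)) (K.sym (K.distribʳ _ _ _))

  ∑-comm : ∀ (xs : List X) (ys : List Y) (f : X → Y → K.Carrier)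
         → ∑ xs (λ x → ∑ ys (f x)) ≈ ∑ ys (λ y → ∑ xs (λ x → f x y))
  ∑-comm []       ys f = K.sym (∑-zero ys (λ _ → K.refl))
  ∑-comm (x ∷ xs) ys f = K.trans (K.+-cong K.refl (∑-comm xs ys f)) (K.sym (∑-+ ys (f x) _))

  ∑-map : ∀ (g : X → Y) (xs : List X) f → ∑ (map g xs) f ≡ ∑ xs (f ∘ g)
  ∑-map g []       f = refl
  ∑-map g (x ∷ xs) f = cong (f (g x) K.+_) (∑-map g xs f)

  [_]·_ : ∀ {p} {Q : Set p} → Dec Q → K.Carrier → K.Carrier
  [ yes _ ]· a = a
  [ no _  ]· a = 0#

  module _ {p q} {P : Set p} {Q : Set q} where

    []·-cong : P ⇔ Q → (P? : Dec P) (Q? : Dec Q) → ∀ {a b} → a ≈ b → [ P? ]· a ≈ [ Q? ]· b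
    []·-cong P⇔Q (yes _) (yes _) a≈b = a≈b
    []·-cong P⇔Q (yes p) (no ¬q) a≈b = ⊥-elim (¬q (to P⇔Q p))
    []·-cong P⇔Q (no ¬p) (yes q) a≈b = ⊥-elim (¬p (from P⇔Q q))
    []·-cong P⇔Q (no _)  (no _)  a≈b = K.refl

  module _ {p} {P : Set p} where

    []·-no : ¬ P → (P? : Dec P) → ∀ a → [ P? ]· a ≈ 0#
    []·-no ¬p (yes p) a = ⊥-elim (¬p p)
    []·-no ¬p (no _)  a = K.refl

    []·-*ˡ : (P? : Dec P) → ∀ a b → [ P? ]· (a K.* b) ≈ a K.* [ P? ]· b
    []·-*ˡ (yes _) a b = K.refl
    []·-*ˡ (no _)  a b = K.sym (K.zeroʳ a)

    []·-*ʳ : (P? : Dec P) → ∀ a b → [ P? ]· (a K.* b) ≈ [ P? ]· a K.* b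
    []·-*ʳ (yes _) a b = K.refl
    []·-*ʳ (no _)  a b = K.sym (K.zeroˡ b)

  restrict : ∀ {p} {P : List (Fin m) → Set p} → (∀ v → Dec (P v)) → K.Carrier × Word → K.Carrier
  restrict P? (b , v) = [ P? (toList v) ]· b

  coeffAt : Word → K.Carrier × Word → K.Carrier
  coeffAt w = restrict (_≟ₗ toList w)

  coeff-∑ : ∀ p w → coeff p w ≈ ∑ p (coeffAt w)
  coeff-∑ []            w = K.refl
  coeff-∑ ((k , u) ∷ p) w with wordEq? u w
  ... | yes _ = K.+-cong K.refl (coeff-∑ p w)
  ... | no _  = K.trans (coeff-∑ p w) (K.sym (K.+-identityˡ _))

  module _ {p} {P : List (Fin m) → Set p} (P? : ∀ v → Dec (P v)) where

    ∑-restrict-unique : ∀ r → (∀ v → P v ⇔ (v ≡ toList r)) → ∀ q → ∑ q (restrict P?) ≈ coeff q r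
    ∑-restrict-unique r sol q = K.trans
      (∑-cong q (λ (b , v) → []·-cong (sol (toList v)) (P? (toList v)) (toList v ≟ₗ toList r) K.refl))
      (K.sym (coeff-∑ q r))

    ∑-restrict-none : (∀ v → ¬ P (toList v)) → ∀ q → ∑ q (restrict P?) ≈ 0#
    ∑-restrict-none none q = ∑-zero q (λ (b , v) → []·-no (none v) (P? (toList v)) b)

    ∑-restrict-cong : AtMostOne P → ∀ q q' → q ≈P q' → ∑ q (restrict P?) ≈ ∑ q' (restrict P?)
    ∑-restrict-cong (inj₁ (r₀ ∷ rs , sol)) q q' q≈q' = begin
      ∑ q (restrict P?)   ≈⟨ ∑-restrict-unique (r₀ ∷ rs) sol q ⟩
      coeff q (r₀ ∷ rs)   ≈⟨ q≈q' (r₀ ∷ rs) ⟩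
      coeff q' (r₀ ∷ rs)  ≈⟨ ∑-restrict-unique (r₀ ∷ rs) sol q' ⟨
      ∑ q' (restrict P?)  ∎
    ∑-restrict-cong (inj₁ ([] , sol)) q q' q≈q' =
      K.trans (∑-restrict-none none q) (K.sym (∑-restrict-none none q'))
      where
      none : ∀ v → ¬ P (toList v)
      none (_ ∷ _) pv with () ← to (sol _) pv
    ∑-restrict-cong (inj₂ none) q q' q≈q' =
      K.trans (∑-restrict-none (none ∘ toList) q) (K.sym (∑-restrict-none (none ∘ toList) q'))

  _⊙_ : K.Carrier × Word → K.Carrier × Word → K.Carrier × Word
  (a , u) ⊙ (b , v) = (a K.* b , u ⁺++⁺ v)

  ∑-*P : ∀ p q (f : K.Carrier × Word → K.Carrier) → ∑ (p *P q) f ≈ ∑ p (λ x → ∑ q (λ y → f (x ⊙ y)))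
  ∑-*P []      q f = K.refl
  ∑-*P (x ∷ p) q f = begin
    ∑ (map (x ⊙_) q ++ p *P q) f          ≈⟨ ∑-++ (map (x ⊙_) q) (p *P q) f ⟩
    ∑ (map (x ⊙_) q) f K.+ ∑ (p *P q) f   ≈⟨ K.+-cong (K.reflexive (∑-map (x ⊙_) q f)) (∑-*P p q f) ⟩
    ∑ (x ∷ p) (λ x → ∑ q (λ y → f (x ⊙ y)))  ∎

  coeff-*P : ∀ p q w → coeff (p *P q) w ≈ ∑ p (λ x → ∑ q (λ y → coeffAt w (x ⊙ y)))
  coeff-*P p q w = K.trans (coeff-∑ (p *P q) w) (∑-*P p q (coeffAt w))

  -- For fixed (a , u), only the word v with u ++ v ≡ w (if any) contributes to this sum.
  ∑-coeffAt-⊙-congʳ : ∀ w x q q' → q ≈P q'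
                    → ∑ q (λ y → coeffAt w (x ⊙ y)) ≈ ∑ q' (λ y → coeffAt w (x ⊙ y))
  ∑-coeffAt-⊙-congʳ w (a , u) q q' q≈q' = begin
    ∑ q (λ y → coeffAt w ((a , u) ⊙ y))   ≈⟨ factor q ⟩
    a K.* ∑ q (restrict P?)               ≈⟨ K.*-cong K.refl (∑-restrict-cong P? solutions q q' q≈q') ⟩
    a K.* ∑ q' (restrict P?)              ≈⟨ factor q' ⟨
    ∑ q' (λ y → coeffAt w ((a , u) ⊙ y))  ∎
    where
    P? : ∀ v → Dec (toList u ++ v ≡ toList w)
    P? v = (toList u ++ v) ≟ₗ toList w
    solutions : AtMostOne (λ v → toList u ++ v ≡ toList w)
    solutions = ++-solveʳ Data.Fin._≟_ (toList u) (toList w)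
    factor : ∀ q → ∑ q (λ y → coeffAt w ((a , u) ⊙ y)) ≈ a K.* ∑ q (restrict P?)
    factor q = K.trans (∑-cong q (λ (b , v) → []·-*ˡ (P? (toList v)) a b)) (∑-*ˡ q a _)

  ∑-coeffAt-⊙-congˡ : ∀ w y p p' → p ≈P p'
                    → ∑ p (λ x → coeffAt w (x ⊙ y)) ≈ ∑ p' (λ x → coeffAt w (x ⊙ y))
  ∑-coeffAt-⊙-congˡ w (b , v) p p' p≈p' = begin
    ∑ p (λ x → coeffAt w (x ⊙ (b , v)))   ≈⟨ factor p ⟩
    ∑ p (restrict P?) K.* b               ≈⟨ K.*-cong (∑-restrict-cong P? solutions p p' p≈p') K.refl ⟩
    ∑ p' (restrict P?) K.* b              ≈⟨ factor p' ⟨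
    ∑ p' (λ x → coeffAt w (x ⊙ (b , v)))  ∎
    where
    P? : ∀ u → Dec (u ++ toList v ≡ toList w)
    P? u = (u ++ toList v) ≟ₗ toList w
    solutions : AtMostOne (λ u → u ++ toList v ≡ toList w)
    solutions = ++-solveˡ Data.Fin._≟_ (toList v) (toList w)
    factor : ∀ p → ∑ p (λ x → coeffAt w (x ⊙ (b , v))) ≈ ∑ p (restrict P?) K.* b
    factor p = K.trans (∑-cong p (λ (a , u) → []·-*ʳ (P? (toList u)) a b)) (∑-*ʳ p b _)

  *P-cong : ∀ p p' q q' → p ≈P p' → q ≈P q' → (p *P q) ≈P (p' *P q')
  *P-cong p p' q q' p≈p' q≈q' w = begin
    coeff (p *P q) w                                   ≈⟨ coeff-*P p q w ⟩
    ∑ p (λ x → ∑ q (λ y → coeffAt w (x ⊙ y)))          ≈⟨ ∑-cong p (λ x → ∑-coeffAt-⊙-congʳ w x q q' q≈q') ⟩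
    ∑ p (λ x → ∑ q' (λ y → coeffAt w (x ⊙ y)))         ≈⟨ ∑-comm p q' _ ⟩
    ∑ q' (λ y → ∑ p (λ x → coeffAt w (x ⊙ y)))         ≈⟨ ∑-cong q' (λ y → ∑-coeffAt-⊙-congˡ w y p p' p≈p') ⟩
    ∑ q' (λ y → ∑ p' (λ x → coeffAt w (x ⊙ y)))        ≈⟨ ∑-comm p' q' _ ⟨
    ∑ p' (λ x → ∑ q' (λ y → coeffAt w (x ⊙ y)))        ≈⟨ coeff-*P p' q' w ⟨
    coeff (p' *P q') w                                 ∎

  *P-assoc : ∀ p q r → ((p *P q) *P r) ≈P (p *P (q *P r))
  *P-assoc p q r w = begin
    coeff ((p *P q) *P r) w                                          ≈⟨ coeff-*P (p *P q) r w ⟩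
    ∑ (p *P q) (λ xy → ∑ r (λ z → coeffAt w (xy ⊙ z)))               ≈⟨ ∑-*P p q _ ⟩
    ∑ p (λ x → ∑ q (λ y → ∑ r (λ z → coeffAt w ((x ⊙ y) ⊙ z))))
      ≈⟨ ∑-cong p (λ x → ∑-cong q (λ y → ∑-cong r (⊙-assoc x y))) ⟩
    ∑ p (λ x → ∑ q (λ y → ∑ r (λ z → coeffAt w (x ⊙ (y ⊙ z)))))      ≈⟨ ∑-cong p (λ x → ∑-*P q r _) ⟨
    ∑ p (λ x → ∑ (q *P r) (λ yz → coeffAt w (x ⊙ yz)))               ≈⟨ coeff-*P p (q *P r) w ⟨
    coeff (p *P (q *P r)) w                                          ∎
    where
    ⊙-assoc : ∀ x y z → coeffAt w ((x ⊙ y) ⊙ z) ≈ coeffAt w (x ⊙ (y ⊙ z))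
    ⊙-assoc (a , u) (b , v) (d , t) =
      []·-cong (mk⇔ (trans (sym (List.++-assoc (toList u) (toList v) (toList t))))
                    (trans (List.++-assoc (toList u) (toList v) (toList t))))
               (toList ((u ⁺++⁺ v) ⁺++⁺ t) ≟ₗ toList w) (toList (u ⁺++⁺ (v ⁺++⁺ t)) ≟ₗ toList w)
               (K.*-assoc a b d)

  coeff-++ : ∀ p q w → coeff (p ++ q) w ≈ coeff p w K.+ coeff q w
  coeff-++ p q w = begin
    coeff (p ++ q) w                                  ≈⟨ coeff-∑ (p ++ q) w ⟩
    ∑ (p ++ q) (coeffAt w)                            ≈⟨ ∑-++ p q (coeffAt w) ⟩
    ∑ p (coeffAt w) K.+ ∑ q (coeffAt w)               ≈⟨ K.+-cong (coeff-∑ p w) (coeff-∑ q w) ⟨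
    coeff p w K.+ coeff q w                           ∎

  -P_ : Poly → Poly
  -P_ = map (map₁ (K.-_))

  coeff-negate : ∀ p w → coeff (-P p) w ≈ K.- coeff p w
  coeff-negate []            w = K.sym +-AbelianGroup.ε⁻¹≈ε
  coeff-negate ((a , u) ∷ p) w with wordEq? u w
  ... | yes _ = K.trans (K.+-cong K.refl (coeff-negate p w)) (+-AbelianGroup.⁻¹-∙-comm a (coeff p w))
  ... | no _  = coeff-negate p w

  ≈P-isEquivalence : IsEquivalence _≈P_
  ≈P-isEquivalence = record
    { refl  = λ w → K.refl
    ; sym   = λ p≈q w → K.sym (p≈q w)
    ; trans = λ p≈q q≈r w → K.trans (p≈q w) (q≈r w)
    }

  ≡⇒≈P : ∀ {p q} → p ≡ q → p ≈P q
  ≡⇒≈P refl w = K.refl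

  +P-cong : ∀ p p' q q' → p ≈P p' → q ≈P q' → (p +P q) ≈P (p' +P q')
  +P-cong p p' q q' p≈p' q≈q' w = begin
    coeff (p ++ q) w            ≈⟨ coeff-++ p q w ⟩
    coeff p w K.+ coeff q w     ≈⟨ K.+-cong (p≈p' w) (q≈q' w) ⟩
    coeff p' w K.+ coeff q' w   ≈⟨ coeff-++ p' q' w ⟨
    coeff (p' ++ q') w          ∎

  +P-comm : ∀ p q → (p +P q) ≈P (q +P p)
  +P-comm p q w = K.trans (coeff-++ p q w) (K.trans (K.+-comm _ _) (K.sym (coeff-++ q p w)))

  -P-cong : ∀ p q → p ≈P q → (-P p) ≈P (-P q)
  -P-cong p q p≈q w = K.trans (coeff-negate p w) (K.trans (K.-‿cong (p≈q w)) (K.sym (coeff-negate q w)))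

  -P-inverseˡ : ∀ p → ((-P p) +P p) ≈P []
  -P-inverseˡ p w = K.trans (coeff-++ (-P p) p w) (K.trans (K.+-cong (coeff-negate p w) K.refl) (K.-‿inverseˡ _))

  -P-inverseʳ : ∀ p → (p +P (-P p)) ≈P []
  -P-inverseʳ p w = K.trans (coeff-++ p (-P p) w) (K.trans (K.+-cong K.refl (coeff-negate p w)) (K.-‿inverseʳ _))

  *P-distribˡ : ∀ p q r → (p *P (q +P r)) ≈P ((p *P q) +P (p *P r))
  *P-distribˡ p q r w = begin
    coeff (p *P (q ++ r)) w                                         ≈⟨ coeff-*P p (q ++ r) w ⟩
    ∑ p (λ x → ∑ (q ++ r) (λ y → coeffAt w (x ⊙ y)))                ≈⟨ ∑-cong p (λ x → ∑-++ q r _) ⟩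
    ∑ p (λ x → ∑ q (λ y → coeffAt w (x ⊙ y)) K.+ ∑ r (λ y → coeffAt w (x ⊙ y)))
                                                                    ≈⟨ ∑-+ p _ _ ⟩
    ∑ p (λ x → ∑ q (λ y → coeffAt w (x ⊙ y))) K.+ ∑ p (λ x → ∑ r (λ y → coeffAt w (x ⊙ y)))
                                                                    ≈⟨ K.+-cong (coeff-*P p q w) (coeff-*P p r w) ⟨
    coeff (p *P q) w K.+ coeff (p *P r) w                           ≈⟨ coeff-++ (p *P q) (p *P r) w ⟨
    coeff ((p *P q) ++ (p *P r)) w                                  ∎

  *P-distribʳ : ∀ p q r → ((q +P r) *P p) ≈P ((q *P p) +P (r *P p))
  *P-distribʳ p q r = ≡⇒≈P (List.concatMap-++ _ q r)

  ring : RingWithoutOne c ℓ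
  ring = record
    { Carrier = Poly ; _≈_ = _≈P_ ; _+_ = _+P_ ; _*_ = _*P_ ; -_ = -P_ ; 0# = []
    ; isRingWithoutOne = record
      { +-isAbelianGroup = record
        { isGroup = record
          { isMonoid = record
            { isSemigroup = record
              { isMagma = record
                { isEquivalence = ≈P-isEquivalence
                ; ∙-cong = λ {p p' q q'} → +P-cong p p' q q' }
              ; assoc = λ p q r → ≡⇒≈P (List.++-assoc p q r) }
            ; identity = (λ p → ≡⇒≈P {p} refl) , (λ p → ≡⇒≈P (List.++-identityʳ p)) }
          ; inverse = -P-inverseˡ , -P-inverseʳ
          ; ⁻¹-cong = λ {p q} → -P-cong p q }
        ; comm = +P-comm }
      ; *-cong = λ {p p' q q'} → *P-cong p p' q q'
      ; *-assoc = *P-assoc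
      ; distrib = *P-distribˡ , *P-distribʳ } }

  monomial : K.Carrier → Word → Poly
  monomial a w = (a , w) ∷ []

  pow⁺-monomial : ∀ a w k → pow⁺ _*P_ (monomial a w) k ≡ monomial (pow⁺ K._*_ a k) (pow⁺ _⁺++⁺_ w k)
  pow⁺-monomial a w zero    = refl
  pow⁺-monomial a w (suc k) = cong (monomial a w *P_) (pow⁺-monomial a w k)

  coeff-monomial : ∀ a w → coeff (monomial a w) w ≈ a
  coeff-monomial a w with wordEq? w w
  ... | yes _  = K.+-identityʳ a
  ... | no w≢w = ⊥-elim (w≢w refl)

  monomial≉0 : ∀ {a} w → ¬ (a ≈ 0#) → ¬ (monomial a w ≈P [])
  monomial≉0 w a≉0 m≈0 = a≉0 (K.trans (K.sym (coeff-monomial _ w)) (m≈0 w))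

  pow⁺-1# : ∀ k → pow⁺ K._*_ 1# k ≈ 1#
  pow⁺-1# zero    = K.refl
  pow⁺-1# (suc k) = K.trans (K.*-identityˡ _) (pow⁺-1# k)

  generator-not-nilpotent : ∀ (x : Fin m) k → ¬ (pow⁺ _*P_ (monomial 1# (x ∷ [])) k ≈P [])
  generator-not-nilpotent x k rewrite pow⁺-monomial 1# (x ∷ []) k =
    monomial≉0 (pow⁺ _⁺++⁺_ (x ∷ []) k) (λ c≈0 → K.0≉1 (K.trans (K.sym c≈0) (pow⁺-1# k)))

module Enumeration where
  open import Data.Nat using (_+_)
  open Relation.Binary.PropositionalEquality.≡-Reasoning

  Enumeration : ∀ {a} → Set a → Set a
  Enumeration A = Σ (ℕ → A) λ f → ∀ x → ∃ λ k → f k ≡ x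

  Enumeration-map : ∀ {a b} {A : Set a} {B : Set b} (f : A → B) → (∀ y → ∃ λ x → f x ≡ y)
                  → Enumeration A → Enumeration B
  Enumeration-map f f-surj (e , e-surj) = f ∘ e , λ y →
    let (x , fx≡y) = f-surj y ; (k , ek≡x) = e-surj x in k , trans (cong f ek≡x) fx≡y

  -- The diagonals a + b = d are walked from (0 , d) to (d , 0).
  next : ℕ × ℕ → ℕ × ℕ
  next (a , zero)  = (zero , suc a)
  next (a , suc b) = (suc a , b)

  pairs : ℕ → ℕ × ℕ
  pairs zero    = (0 , 0)
  pairs (suc n) = next (pairs n)

  pairs-walk : ∀ k {a b n} → pairs n ≡ (a , k + b) → pairs (k + n) ≡ (k + a , b)
  pairs-walk zero    e = e
  pairs-walk (suc k) {a} {b} {n} e = begin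
    pairs (suc k + n)    ≡⟨ cong pairs (sym (ℕ.+-suc k n)) ⟩
    pairs (k + suc n)    ≡⟨ pairs-walk k (cong next e) ⟩
    (k + suc a , b)      ≡⟨ cong (_, b) (ℕ.+-suc k a) ⟩
    (suc k + a , b)      ∎

  pairs-diagonal : ∀ d → ∃ λ n → pairs n ≡ (0 , d)
  pairs-diagonal zero    = 0 , refl
  pairs-diagonal (suc d) with n , e ← pairs-diagonal d =
    suc (d + n) , trans (cong next (pairs-walk d (trans e (cong (0 ,_) d≡d+0))))
                        (cong (λ x → (0 , suc x)) (sym d≡d+0))
    where
    d≡d+0 : d ≡ d + 0
    d≡d+0 = sym (ℕ.+-identityʳ d)

  pairs-surjective : ∀ a b → ∃ λ n → pairs n ≡ (a , b)
  pairs-surjective a b with n , e ← pairs-diagonal (a + b) =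
    a + n , trans (pairs-walk a e) (cong (_, b) (ℕ.+-identityʳ a))

  ℕ×ℕ-enumeration : Enumeration (ℕ × ℕ)
  ℕ×ℕ-enumeration = pairs , uncurry pairs-surjective

  data Tree : Set where
    leaf : ℕ → Tree
    node : Tree → Tree → Tree

  grow : (ℕ → Tree) → ℕ × ℕ → Tree
  grow t (zero  , r) = leaf r
  grow t (suc _ , r) = node (t (proj₁ (pairs r))) (t (proj₂ (pairs r)))

  -- unfold f decodes a number into a tree of depth below f.
  unfold : ℕ → ℕ → Tree
  unfold zero    n = leaf 0
  unfold (suc f) n = grow (unfold f) (pairs n)

  unfold-surjective : ∀ t → ∃ λ f → ∀ {f'} → f ≤ f' → ∃ λ n → unfold f' n ≡ t
  unfold-surjective (leaf r) = 1 , λ { {suc f'} _ →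
    let (n , e) = pairs-surjective 0 r in n , cong (grow (unfold f')) e }
  unfold-surjective (node t₁ t₂) with f₁ , h₁ ← unfold-surjective t₁ | f₂ , h₂ ← unfold-surjective t₂ =
    suc (f₁ ⊔ℕ f₂) , λ { {suc f'} (s≤s f₁⊔f₂≤f') →
      let (n₁ , e₁) = h₁ (ℕ.≤-trans (ℕ.m≤m⊔n f₁ f₂) f₁⊔f₂≤f')
          (n₂ , e₂) = h₂ (ℕ.≤-trans (ℕ.m≤n⊔m f₁ f₂) f₁⊔f₂≤f')
          (r , er)  = pairs-surjective n₁ n₂
          (n , en)  = pairs-surjective 1 r
      in n , trans (cong (grow (unfold f')) en)
                   (trans (cong (λ p → node (unfold f' (proj₁ p)) (unfold f' (proj₂ p))) er)
                          (cong₂ node e₁ e₂)) }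

  Tree-enumeration : Enumeration Tree
  Tree-enumeration = Enumeration-map (uncurry unfold) surjective ℕ×ℕ-enumeration
    where
    surjective : ∀ t → ∃ λ fn → uncurry unfold fn ≡ t
    surjective t with f , h ← unfold-surjective t with n , e ← h ℕ.≤-refl = (f , n) , e

  Enumeration-retract : ∀ {a} {A : Set a} (encode : A → Tree) (decode : Tree → A)
                      → (∀ x → decode (encode x) ≡ x) → Enumeration A
  Enumeration-retract encode decode inverse =
    Enumeration-map decode (λ x → encode x , inverse x) Tree-enumeration

  encodeTerm : ∀ {n} → Term n → Tree
  encodeTerm (var i) = node (leaf 0) (leaf (toℕ i))
  encodeTerm zer     = leaf 0
  encodeTerm (s ⊕ t) = node (leaf 1) (node (encodeTerm s) (encodeTerm t))
  encodeTerm (s ⊗ t) = node (leaf 2) (node (encodeTerm s) (encodeTerm t))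

  decodeVar : ∀ n → ℕ → Term n
  decodeVar n r with r <? n
  ... | yes r<n = var (fromℕ< r<n)
  ... | no _    = zer

  decodeTerm : ∀ n → Tree → Term n
  decodeTerm n (node (leaf 0) (leaf r))   = decodeVar n r
  decodeTerm n (node (leaf 1) (node s t)) = decodeTerm n s ⊕ decodeTerm n t
  decodeTerm n (node (leaf 2) (node s t)) = decodeTerm n s ⊗ decodeTerm n t
  decodeTerm n _                          = zer

  decode-encodeTerm : ∀ {n} (t : Term n) → decodeTerm n (encodeTerm t) ≡ t
  decode-encodeTerm {n} (var i) with toℕ i <? n
  ... | yes i<n = cong var (Finₚ.fromℕ<-toℕ i i<n)
  ... | no i≮n  = ⊥-elim (i≮n (Finₚ.toℕ<n i))
  decode-encodeTerm zer     = refl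
  decode-encodeTerm (s ⊕ t) = cong₂ _⊕_ (decode-encodeTerm s) (decode-encodeTerm t)
  decode-encodeTerm (s ⊗ t) = cong₂ _⊗_ (decode-encodeTerm s) (decode-encodeTerm t)

  encodeFormula : ∀ {n} → Formula n → Tree
  encodeFormula (s ≐ t)  = node (leaf 0) (node (encodeTerm s) (encodeTerm t))
  encodeFormula fls      = leaf 0
  encodeFormula tru      = leaf 1
  encodeFormula (φ ∧' ψ) = node (leaf 1) (node (encodeFormula φ) (encodeFormula ψ))
  encodeFormula (φ ∨' ψ) = node (leaf 2) (node (encodeFormula φ) (encodeFormula ψ))
  encodeFormula (φ ⇒' ψ) = node (leaf 3) (node (encodeFormula φ) (encodeFormula ψ))
  encodeFormula (¬' φ)   = node (leaf 4) (encodeFormula φ)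
  encodeFormula (∀' φ)   = node (leaf 5) (encodeFormula φ)
  encodeFormula (∃' φ)   = node (leaf 6) (encodeFormula φ)

  decodeFormula : ∀ n → Tree → Formula n
  decodeFormula n (node (leaf 0) (node s t)) = decodeTerm n s ≐ decodeTerm n t
  decodeFormula n (leaf 1)                   = tru
  decodeFormula n (node (leaf 1) (node φ ψ)) = decodeFormula n φ ∧' decodeFormula n ψ
  decodeFormula n (node (leaf 2) (node φ ψ)) = decodeFormula n φ ∨' decodeFormula n ψ
  decodeFormula n (node (leaf 3) (node φ ψ)) = decodeFormula n φ ⇒' decodeFormula n ψ
  decodeFormula n (node (leaf 4) φ)          = ¬' decodeFormula n φ
  decodeFormula n (node (leaf 5) φ)          = ∀' decodeFormula (suc n) φ
  decodeFormula n (node (leaf 6) φ)          = ∃' decodeFormula (suc n) φ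
  decodeFormula n _                          = fls

  decode-encodeFormula : ∀ {n} (φ : Formula n) → decodeFormula n (encodeFormula φ) ≡ φ
  decode-encodeFormula (s ≐ t)  = cong₂ _≐_ (decode-encodeTerm s) (decode-encodeTerm t)
  decode-encodeFormula fls      = refl
  decode-encodeFormula tru      = refl
  decode-encodeFormula (φ ∧' ψ) = cong₂ _∧'_ (decode-encodeFormula φ) (decode-encodeFormula ψ)
  decode-encodeFormula (φ ∨' ψ) = cong₂ _∨'_ (decode-encodeFormula φ) (decode-encodeFormula ψ)
  decode-encodeFormula (φ ⇒' ψ) = cong₂ _⇒'_ (decode-encodeFormula φ) (decode-encodeFormula ψ)
  decode-encodeFormula (¬' φ)   = cong ¬'_ (decode-encodeFormula φ)
  decode-encodeFormula (∀' φ)   = cong ∀'_ (decode-encodeFormula φ)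
  decode-encodeFormula (∃' φ)   = cong ∃'_ (decode-encodeFormula φ)

open Enumeration

module CountablyDecidingFilter {p} (lem : ∀ {a} → ExcludedMiddle a) (S : ℕ → Pred ℕ p) where
  open import Data.Nat using (_+_)

  open Often using (Inf)

  -- Working with decided copies of the S j keeps the filter at the level of the sets it measures.
  decided : ℕ → Pred ℕ 0ℓ
  decided j i = True (lem {P = S j i})

  refine : (D T : Pred ℕ 0ℓ) → Dec (Inf (D ∩ T)) → Pred ℕ 0ℓ
  refine D T (yes _) = D ∩ T
  refine D T (no _)  = D ∩ ∁ T

  refine-⊆ : ∀ D T d → refine D T d ⊆ D
  refine-⊆ D T (yes _) = proj₁
  refine-⊆ D T (no _)  = proj₁

  refine-decides : ∀ D T d → refine D T d ⊆ T ⊎ refine D T d ⊆ ∁ T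
  refine-decides D T (yes _) = inj₁ proj₂
  refine-decides D T (no _)  = inj₂ proj₂

  refine-Inf : ∀ D T d → Inf D → Inf (refine D T d)
  refine-Inf D T (yes inf-D∩T) inf-D = inf-D∩T
  refine-Inf D T (no ¬inf-D∩T) inf-D fin-D∖T =
    Often.map split inf-D (decidable-stable lem ¬inf-D∩T Often.∪-Fin fin-D∖T)
    where
    split : D ⊆ (D ∩ T) ∪ (D ∩ ∁ T)
    split {i} d with lem {P = T i}
    ... | yes t = inj₁ (d , t)
    ... | no ¬t = inj₂ (d , ¬t)

  -- chain J is an infinite set deciding each of S 0, …, S (J - 1).
  chain : ℕ → Pred ℕ 0ℓ
  chain zero    = λ _ → ⊤
  chain (suc J) = refine (chain J) (decided J) lem

  chain-Inf : ∀ J → Inf (chain J)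
  chain-Inf zero    (N , fin) = fin N ℕ.≤-refl _
  chain-Inf (suc J) = refine-Inf (chain J) (decided J) lem (chain-Inf J)

  chain-antitone : ∀ k J → chain (k + J) ⊆ chain J
  chain-antitone zero    J = id
  chain-antitone (suc k) J = chain-antitone k J ∘′ refine-⊆ (chain (k + J)) (decided (k + J)) lem

  Large : ∀ {b} → Pred ℕ b → Set b
  Large X = ∃ λ J → ∃ λ N → ∀ i → N ≤ i → chain J i → X i

  module _ {b c} {X : Pred ℕ b} {Y : Pred ℕ c} where

    Large-mono : X ⊆ Y → Large X → Large Y
    Large-mono X⊆Y (J , N , large) = J , N , λ i N≤i i∈J → X⊆Y (large i N≤i i∈J)

    Large-∩ : Large X → Large Y → Large (X ∩ Y)
    Large-∩ (J₁ , N₁ , large₁) (J₂ , N₂ , large₂) = J₁ + J₂ , N₁ ⊔ℕ N₂ , λ i N≤i i∈J →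
        large₁ i (ℕ.≤-trans (ℕ.m≤m⊔n N₁ N₂) N≤i)
                 (chain-antitone J₂ J₁ (subst (λ J → chain J i) (ℕ.+-comm J₁ J₂) i∈J))
      , large₂ i (ℕ.≤-trans (ℕ.m≤n⊔m N₁ N₂) N≤i) (chain-antitone J₁ J₂ i∈J)

  module _ {b} {X : Pred ℕ b} where

    Large-universal : (∀ i → X i) → Large X
    Large-universal all = 0 , 0 , λ i _ _ → all i

    Large-nonempty : Large X → ¬ Empty X
    Large-nonempty (J , N , large) empty = chain-Inf J (N , λ i N≤i i∈J → empty i (large i N≤i i∈J))

  Large-decides : ∀ j → Large (S j) ⊎ Large (∁ (S j))
  Large-decides j with refine-decides (chain j) (decided j) lem
  ... | inj₁ ⊆S  = inj₁ (suc j , 0 , λ i _ i∈J → toWitness (⊆S i∈J))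
  ... | inj₂ ⊆∁S = inj₂ (suc j , 0 , λ i _ i∈J → ¬True⇒¬ (lem {P = S j i}) (⊆∁S i∈J))
    where
    ¬True⇒¬ : ∀ {q} {Q : Set q} (Q? : Dec Q) → ¬ True Q? → ¬ Q
    ¬True⇒¬ (yes q) ¬true = ⊥-elim (¬true _)
    ¬True⇒¬ (no ¬q) _     = ¬q

module _ {c ℓ} (N : RingLangStructure c ℓ) where
  private module N = RingLangStructure N
  open N using (Carrier; _≈_)

  ⟦⟧t-cong : ∀ {n} (t : Term n) {ρ ρ' : Fin n → Carrier} → ρ ≗ ρ' → ⟦_⟧t N t ρ ≡ ⟦_⟧t N t ρ'
  ⟦⟧t-cong (var i) ρ≗ρ' = ρ≗ρ' i
  ⟦⟧t-cong zer     ρ≗ρ' = refl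
  ⟦⟧t-cong (s ⊕ t) ρ≗ρ' = cong₂ N._+_ (⟦⟧t-cong s ρ≗ρ') (⟦⟧t-cong t ρ≗ρ')
  ⟦⟧t-cong (s ⊗ t) ρ≗ρ' = cong₂ N._*_ (⟦⟧t-cong s ρ≗ρ') (⟦⟧t-cong t ρ≗ρ')

  extend-cong : ∀ {n} x {ρ ρ' : Fin n → Carrier} → ρ ≗ ρ' → extend N x ρ ≗ extend N x ρ'
  extend-cong x ρ≗ρ' fzero    = refl
  extend-cong x ρ≗ρ' (fsuc i) = ρ≗ρ' i

  Sat-cong : ∀ {n} (φ : Formula n) {ρ ρ' : Fin n → Carrier} → ρ ≗ ρ' → Sat N φ ρ → Sat N φ ρ'
  Sat-cong (s ≐ t)  ρ≗ρ' (lift s≈t) =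
    lift (subst₂ _≈_ (⟦⟧t-cong s ρ≗ρ') (⟦⟧t-cong t ρ≗ρ') s≈t)
  Sat-cong fls      ρ≗ρ' ()
  Sat-cong tru      ρ≗ρ' _ = _
  Sat-cong (φ ∧' ψ) ρ≗ρ' (sφ , sψ) = Sat-cong φ ρ≗ρ' sφ , Sat-cong ψ ρ≗ρ' sψ
  Sat-cong (φ ∨' ψ) ρ≗ρ' (inj₁ sφ) = inj₁ (Sat-cong φ ρ≗ρ' sφ)
  Sat-cong (φ ∨' ψ) ρ≗ρ' (inj₂ sψ) = inj₂ (Sat-cong ψ ρ≗ρ' sψ)
  Sat-cong (φ ⇒' ψ) ρ≗ρ' sφ⇒sψ = Sat-cong ψ ρ≗ρ' ∘ sφ⇒sψ ∘ Sat-cong φ (sym ∘ ρ≗ρ')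
  Sat-cong (¬' φ)   ρ≗ρ' ¬sφ = ¬sφ ∘ Sat-cong φ (sym ∘ ρ≗ρ')
  Sat-cong (∀' φ)   ρ≗ρ' sφ x = Sat-cong φ (extend-cong x ρ≗ρ') (sφ x)
  Sat-cong (∃' φ)   ρ≗ρ' (x , sφ) = x , Sat-cong φ (extend-cong x ρ≗ρ') sφ

Enumeration⇒Countable : ∀ {c ℓ} (R : RingWithoutOne c ℓ)
                      → Enumeration (RingWithoutOne.Carrier R) → Countable R
Enumeration⇒Countable R (f , f-surjective) = f , λ x →
  let (k , fk≡x) = f-surjective x in k , RingWithoutOne.reflexive R fk≡x

module SkolemUltrapower {c ℓ} (lem : ∀ {a} → ExcludedMiddle a) (R : RingWithoutOne c ℓ)
                        (g : RingWithoutOne.Carrier R) where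
  private module R = RingWithoutOne R
  open R using (Carrier; _≈_; _+_; _*_; -_; 0#)

  M : RingLangStructure c ℓ
  M = reduct R

  infixl 7 _*ₛ_
  infixl 6 _+ₛ_

  data STerm : Set c where
    gₛ     : STerm
    powₛ   : ℕ → STerm
    0ₛ     : STerm
    _+ₛ_   : STerm → STerm → STerm
    _*ₛ_   : STerm → STerm → STerm
    -ₛ_    : STerm → STerm
    skolem : (k : ℕ) → Formula (suc k) → Vec STerm k → STerm

  pick : ∀ {p} {P : Carrier → Set p} → Dec (Σ Carrier P) → Carrier
  pick (yes (x , _)) = x
  pick (no _)        = 0#

  pick-spec : ∀ {p} {P : Carrier → Set p} (d : Dec (Σ Carrier P)) → Σ Carrier P → P (pick d)
  pick-spec (yes (x , px)) _ = px
  pick-spec (no ∄x)        ∃x = ⊥-elim (∄x ∃x)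

  -- A Skolem term t names the sequence (val t i)ᵢ of elements of R.
  mutual
    val : STerm → ℕ → Carrier
    val gₛ             i = g
    val (powₛ r)       i = pow⁺ _*_ g (i ∸ r)
    val 0ₛ             i = 0#
    val (s +ₛ t)       i = val s i + val t i
    val (s *ₛ t)       i = val s i * val t i
    val (-ₛ s)         i = - val s i
    val (skolem k φ v) i = pick (lem {P = ∃ λ x → Sat M φ (extend M x (lookup (valVec v i)))})

    valVec : ∀ {k} → Vec STerm k → ℕ → Vec Carrier k
    valVec []      i = []
    valVec (s ∷ v) i = val s i ∷ valVec v i

  _at_ : ∀ {n} → (Fin n → STerm) → ℕ → Fin n → Carrier
  (ρ at i) x = val (ρ x) i

  lookup-valVec-tabulate : ∀ {n} (ρ : Fin n → STerm) i → lookup (valVec (tabulate ρ) i) ≗ ρ at i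
  lookup-valVec-tabulate ρ i fzero    = refl
  lookup-valVec-tabulate ρ i (fsuc x) = lookup-valVec-tabulate (ρ ∘ fsuc) i x

  mutual
    encodeSTerm : STerm → Tree
    encodeSTerm gₛ             = leaf 0
    encodeSTerm 0ₛ             = leaf 1
    encodeSTerm (powₛ r)       = node (leaf 0) (leaf r)
    encodeSTerm (s +ₛ t)       = node (leaf 1) (node (encodeSTerm s) (encodeSTerm t))
    encodeSTerm (s *ₛ t)       = node (leaf 2) (node (encodeSTerm s) (encodeSTerm t))
    encodeSTerm (-ₛ s)         = node (leaf 3) (encodeSTerm s)
    encodeSTerm (skolem k φ v) = node (leaf 4) (node (leaf k) (node (encodeFormula φ) (encodeVec v)))

    encodeVec : ∀ {k} → Vec STerm k → Tree
    encodeVec []      = leaf 0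
    encodeVec (s ∷ v) = node (encodeSTerm s) (encodeVec v)

  mutual
    decodeSTerm : Tree → STerm
    decodeSTerm (leaf 0)                                       = gₛ
    decodeSTerm (node (leaf 0) (leaf r))                       = powₛ r
    decodeSTerm (node (leaf 1) (node s t))                     = decodeSTerm s +ₛ decodeSTerm t
    decodeSTerm (node (leaf 2) (node s t))                     = decodeSTerm s *ₛ decodeSTerm t
    decodeSTerm (node (leaf 3) s)                              = -ₛ decodeSTerm s
    decodeSTerm (node (leaf 4) (node (leaf k) (node φ v)))     = skolem k (decodeFormula (suc k) φ) (decodeVec k v)
    decodeSTerm _                                              = 0ₛ

    decodeVec : ∀ k → Tree → Vec STerm k
    decodeVec zero    _          = []
    decodeVec (suc k) (node s v) = decodeSTerm s ∷ decodeVec k v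
    decodeVec (suc k) (leaf _)   = replicate (suc k) 0ₛ

  mutual
    decode-encodeSTerm : ∀ s → decodeSTerm (encodeSTerm s) ≡ s
    decode-encodeSTerm gₛ             = refl
    decode-encodeSTerm 0ₛ             = refl
    decode-encodeSTerm (powₛ r)       = refl
    decode-encodeSTerm (s +ₛ t)       = cong₂ _+ₛ_ (decode-encodeSTerm s) (decode-encodeSTerm t)
    decode-encodeSTerm (s *ₛ t)       = cong₂ _*ₛ_ (decode-encodeSTerm s) (decode-encodeSTerm t)
    decode-encodeSTerm (-ₛ s)         = cong -ₛ_ (decode-encodeSTerm s)
    decode-encodeSTerm (skolem k φ v) = cong₂ (skolem k) (decode-encodeFormula φ) (decode-encodeVec v)

    decode-encodeVec : ∀ {k} (v : Vec STerm k) → decodeVec k (encodeVec v) ≡ v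
    decode-encodeVec []      = refl
    decode-encodeVec (s ∷ v) = cong₂ _∷_ (decode-encodeSTerm s) (decode-encodeVec v)

  STerm-enumeration : Enumeration STerm
  STerm-enumeration = Enumeration-retract encodeSTerm decodeSTerm decode-encodeSTerm

  Instance : Set c
  Instance = ∃ λ k → Formula k × Vec STerm k

  Instance-enumeration : Enumeration Instance
  Instance-enumeration = Enumeration-retract encode decode decode-encode
    where
    encode : Instance → Tree
    encode (k , φ , v) = node (leaf k) (node (encodeFormula φ) (encodeVec v))
    decode : Tree → Instance
    decode (node (leaf k) (node φ v)) = k , decodeFormula k φ , decodeVec k v
    decode _                          = 0 , fls , []
    decode-encode : ∀ I → decode (encode I) ≡ I
    decode-encode (k , φ , v) = cong₂ (λ φ v → k , φ , v) (decode-encodeFormula φ) (decode-encodeVec v)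

  holdsAt : Instance → Pred ℕ (c ⊔ ℓ)
  holdsAt (k , φ , v) i = Sat M φ (lookup (valVec v i))

  open CountablyDecidingFilter lem (holdsAt ∘ proj₁ Instance-enumeration)

  Holds : ∀ {n} → Formula n → (Fin n → STerm) → Pred ℕ (c ⊔ ℓ)
  Holds φ ρ i = Sat M φ (ρ at i)

  Large-decides-Holds : ∀ {n} (φ : Formula n) ρ → Large (Holds φ ρ) ⊎ Large (∁ (Holds φ ρ))
  Large-decides-Holds {n} φ ρ with j , e ← proj₂ Instance-enumeration (n , φ , tabulate ρ)
                               with Large-decides j
  ... | inj₁ large = inj₁ (Large-mono (λ {i} → Sat-cong M φ (lookup-valVec-tabulate ρ i)
                                               ∘ subst (λ I → holdsAt I i) e) large)
  ... | inj₂ large = inj₂ (Large-mono (λ {i} ¬h → ¬h ∘ subst (λ I → holdsAt I i) (sym e)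
                                                     ∘ Sat-cong M φ (sym ∘ lookup-valVec-tabulate ρ i)) large)

  infix 4 _≈ᴮ_
  _≈ᴮ_ : STerm → STerm → Set ℓ
  s ≈ᴮ t = Large (λ i → val s i ≈ val t i)

  B : RingWithoutOne c ℓ
  B = record
    { Carrier = STerm ; _≈_ = _≈ᴮ_ ; _+_ = _+ₛ_ ; _*_ = _*ₛ_ ; -_ = -ₛ_ ; 0# = 0ₛ
    ; isRingWithoutOne = record
      { +-isAbelianGroup = record
        { isGroup = record
          { isMonoid = record
            { isSemigroup = record
              { isMagma = record
                { isEquivalence = record
                  { refl  = Large-universal (λ i → R.refl)
                  ; sym   = Large-mono R.sym
                  ; trans = λ s≈t t≈u → Large-mono (uncurry R.trans) (Large-∩ s≈t t≈u) }
                ; ∙-cong = λ s≈s' t≈t' → Large-mono (uncurry R.+-cong) (Large-∩ s≈s' t≈t') }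
              ; assoc = λ s t u → Large-universal (λ i → R.+-assoc (val s i) (val t i) (val u i)) }
            ; identity = (λ s → Large-universal (λ i → R.+-identityˡ (val s i)))
                       , (λ s → Large-universal (λ i → R.+-identityʳ (val s i))) }
          ; inverse = (λ s → Large-universal (λ i → R.-‿inverseˡ (val s i)))
                    , (λ s → Large-universal (λ i → R.-‿inverseʳ (val s i)))
          ; ⁻¹-cong = Large-mono R.-‿cong }
        ; comm = λ s t → Large-universal (λ i → R.+-comm (val s i) (val t i)) }
      ; *-cong = λ s≈s' t≈t' → Large-mono (uncurry R.*-cong) (Large-∩ s≈s' t≈t')
      ; *-assoc = λ s t u → Large-universal (λ i → R.*-assoc (val s i) (val t i) (val u i))
      ; distrib = (λ s t u → Large-universal (λ i → R.distribˡ (val s i) (val t i) (val u i)))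
                , (λ s t u → Large-universal (λ i → R.distribʳ (val s i) (val t i) (val u i))) } }

  RB : RingLangStructure c ℓ
  RB = reduct B

  val-⟦⟧t : ∀ {n} (t : Term n) (ρ : Fin n → STerm) i → val (⟦_⟧t RB t ρ) i ≡ ⟦_⟧t M t (ρ at i)
  val-⟦⟧t (var x) ρ i = refl
  val-⟦⟧t zer     ρ i = refl
  val-⟦⟧t (s ⊕ t) ρ i = cong₂ _+_ (val-⟦⟧t s ρ i) (val-⟦⟧t t ρ i)
  val-⟦⟧t (s ⊗ t) ρ i = cong₂ _*_ (val-⟦⟧t s ρ i) (val-⟦⟧t t ρ i)

  extend-at : ∀ {n} s (ρ : Fin n → STerm) i → extend RB s ρ at i ≗ extend M (val s i) (ρ at i)
  extend-at s ρ i fzero    = refl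
  extend-at s ρ i (fsuc x) = refl

  skolem-spec : ∀ {n} (φ : Formula (suc n)) (ρ : Fin n → STerm) {i}
              → Holds (∃' φ) ρ i → Holds φ (extend RB (skolem n φ (tabulate ρ)) ρ) i
  skolem-spec {n} φ ρ {i} (x , sφ) =
    Sat-cong M φ (λ { fzero → refl ; (fsuc y) → lookup-valVec-tabulate ρ i y })
      (pick-spec {P = λ y → Sat M φ (extend M y σ)} lem
        (x , Sat-cong M φ (extend-cong M x (sym ∘ lookup-valVec-tabulate ρ i)) sφ))
    where
    σ : Fin n → Carrier
    σ = lookup (valVec (tabulate ρ) i)

  Łoś : ∀ {n} → Formula n → Set (c ⊔ ℓ)
  Łoś φ = ∀ ρ → Sat RB φ ρ ⇔ Large (Holds φ ρ)

  module _ {n : ℕ} where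

    Łoś-≐ : ∀ (s t : Term n) → Łoś (s ≐ t)
    Łoś-≐ s t ρ = mk⇔
      (λ (lift s≈t) → Large-mono (λ {i} → lift ∘ subst₂ _≈_ (val-⟦⟧t s ρ i) (val-⟦⟧t t ρ i)) s≈t)
      (λ large → lift (Large-mono (λ {i} → subst₂ _≈_ (sym (val-⟦⟧t s ρ i)) (sym (val-⟦⟧t t ρ i)) ∘ lower) large))

    Łoś-fls : Łoś {n} fls
    Łoś-fls ρ = mk⇔ (λ ()) (λ large → ⊥-elim (Large-nonempty large (λ i ())))

    Łoś-tru : Łoś {n} tru
    Łoś-tru ρ = mk⇔ (λ _ → Large-universal (λ i → _)) (λ _ → _)

    Łoś-∧ : ∀ {φ ψ : Formula n} → Łoś φ → Łoś ψ → Łoś (φ ∧' ψ)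
    Łoś-∧ łoś-φ łoś-ψ ρ = mk⇔
      (λ (sφ , sψ) → Large-∩ (to (łoś-φ ρ) sφ) (to (łoś-ψ ρ) sψ))
      (λ large → from (łoś-φ ρ) (Large-mono proj₁ large) , from (łoś-ψ ρ) (Large-mono proj₂ large))

    Łoś-∨ : ∀ {φ ψ : Formula n} → Łoś φ → Łoś ψ → Łoś (φ ∨' ψ)
    Łoś-∨ {φ} {ψ} łoś-φ łoś-ψ ρ = mk⇔ [ Large-mono inj₁ ∘ to (łoś-φ ρ) , Large-mono inj₂ ∘ to (łoś-ψ ρ) ] from′
      where
      from′ : Large (Holds (φ ∨' ψ) ρ) → Sat RB (φ ∨' ψ) ρ
      from′ large with Large-decides-Holds φ ρ
      ... | inj₁ large-φ  = inj₁ (from (łoś-φ ρ) large-φ)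
      ... | inj₂ large-¬φ = inj₂ (from (łoś-ψ ρ) (Large-mono (λ (hφ∨hψ , ¬hφ) → [ ⊥-elim ∘ ¬hφ , id ] hφ∨hψ)
                                                                (Large-∩ large large-¬φ)))

    Łoś-⇒ : ∀ {φ ψ : Formula n} → Łoś φ → Łoś ψ → Łoś (φ ⇒' ψ)
    Łoś-⇒ {φ} {ψ} łoś-φ łoś-ψ ρ = mk⇔ to′
      (λ large sφ → from (łoś-ψ ρ) (Large-mono (λ (hφ⇒hψ , hφ) → hφ⇒hψ hφ) (Large-∩ large (to (łoś-φ ρ) sφ))))
      where
      to′ : Sat RB (φ ⇒' ψ) ρ → Large (Holds (φ ⇒' ψ) ρ)
      to′ sφ⇒sψ with Large-decides-Holds φ ρ
      ... | inj₁ large-φ  = Large-mono (λ hψ _ → hψ) (to (łoś-ψ ρ) (sφ⇒sψ (from (łoś-φ ρ) large-φ)))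
      ... | inj₂ large-¬φ = Large-mono (λ ¬hφ hφ → ⊥-elim (¬hφ hφ)) large-¬φ

    Łoś-¬ : ∀ {φ : Formula n} → Łoś φ → Łoś (¬' φ)
    Łoś-¬ {φ} łoś-φ ρ = mk⇔ to′
      (λ large sφ → Large-nonempty (Large-∩ large (to (łoś-φ ρ) sφ)) (λ i (¬hφ , hφ) → ¬hφ hφ))
      where
      to′ : Sat RB (¬' φ) ρ → Large (Holds (¬' φ) ρ)
      to′ ¬sφ with Large-decides-Holds φ ρ
      ... | inj₁ large-φ  = ⊥-elim (¬sφ (from (łoś-φ ρ) large-φ))
      ... | inj₂ large-¬φ = large-¬φ

    Łoś-∃ : ∀ {φ : Formula (suc n)} → Łoś φ → Łoś (∃' φ)
    Łoś-∃ {φ} łoś-φ ρ = mk⇔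
      (λ (s , sφ) → Large-mono (λ {i} hφ → val s i , Sat-cong M φ (extend-at s ρ i) hφ)
                               (to (łoś-φ (extend RB s ρ)) sφ))
      (λ large → skolem n φ (tabulate ρ) , from (łoś-φ _) (Large-mono (skolem-spec φ ρ) large))

    -- The witness of a counterexample to φ is the test element for ∀' φ.
    Łoś-∀ : ∀ {φ : Formula (suc n)} → Łoś φ → Łoś (∀' φ)
    Łoś-∀ {φ} łoś-φ ρ = mk⇔
      (λ ∀sφ → Large-mono no-counterexample (to (łoś-φ _) (∀sφ counterexample)))
      (λ large s → from (łoś-φ (extend RB s ρ))
                          (Large-mono (λ {i} ∀hφ → Sat-cong M φ (sym ∘ extend-at s ρ i) (∀hφ (val s i))) large))
      where
      counterexample : STerm
      counterexample = skolem n (¬' φ) (tabulate ρ)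
      no-counterexample : Holds φ (extend RB counterexample ρ) ⊆ Holds (∀' φ) ρ
      no-counterexample {i} hφ x with lem {P = Sat M φ (extend M x (ρ at i))}
      ... | yes hφx = hφx
      ... | no ¬hφx = ⊥-elim (skolem-spec (¬' φ) ρ (x , ¬hφx) hφ)

  łoś : ∀ {n} (φ : Formula n) → Łoś φ
  łoś (s ≐ t)  = Łoś-≐ s t
  łoś fls      = Łoś-fls
  łoś tru      = Łoś-tru
  łoś (φ ∧' ψ) = Łoś-∧ (łoś φ) (łoś ψ)
  łoś (φ ∨' ψ) = Łoś-∨ (łoś φ) (łoś ψ)
  łoś (φ ⇒' ψ) = Łoś-⇒ (łoś φ) (łoś ψ)
  łoś (¬' φ)   = Łoś-¬ (łoś φ)
  łoś (∀' φ)   = Łoś-∀ (łoś φ)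
  łoś (∃' φ)   = Łoś-∃ (łoś φ)

  B≡R : ElemEquiv RB M
  B≡R φ = (λ sat → decidable-stable lem (λ ¬sat →
             Large-nonempty (to (łoś φ _) sat) (λ i → ¬sat ∘ Sat-cong M φ (λ ()))))
        , (λ sat → from (łoś φ _) (Large-universal (λ i → Sat-cong M φ (λ ()) sat)))

  gₛ^_·_ : ℕ → STerm → STerm × List STerm
  gₛ^ zero  · s = s , []
  gₛ^ suc k · s = gₛ , uncurry _∷_ (gₛ^ k · s)

  length-gₛ^· : ∀ k s → length (proj₂ (gₛ^ k · s)) ≡ k
  length-gₛ^· zero    s = refl
  length-gₛ^· (suc k) s = cong suc (length-gₛ^· k s)

  val-gₛ^·powₛ : ∀ k r i → val (uncurry (prod⁺ B) (gₛ^ k · powₛ r)) i ≡ pow⁺ _*_ g (k +ℕ (i ∸ r))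
  val-gₛ^·powₛ zero    r i = refl
  val-gₛ^·powₛ (suc k) r i = cong (g *_) (val-gₛ^·powₛ k r i)

  -- From index k on, g^k · g^(i+1-k) = g^(i+1).
  powₛ0∈B^ : ∀ n → n ≥ 1 → InPow B n (powₛ 0)
  powₛ0∈B^ (suc k) _ =
    InPow.resp product≈powₛ0 (InPow.gen (proj₁ factors) (proj₂ factors) (cong suc (length-gₛ^· k (powₛ k))))
    where
    factors : STerm × List STerm
    factors = gₛ^ k · powₛ k
    product≈powₛ0 : uncurry (prod⁺ B) factors ≈ᴮ powₛ 0
    product≈powₛ0 = 0 , k , λ i k≤i _ →
      R.reflexive (trans (val-gₛ^·powₛ k k i) (cong (pow⁺ _*_ g) (ℕ.m+[n∸m]≡n k≤i)))

  B-not-residually-nilpotent : (∀ k → ¬ (pow⁺ _*_ g k ≈ 0#)) → ¬ ResiduallyNilpotent B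
  B-not-residually-nilpotent g-not-nilpotent B-residually-nilpotent =
    Large-nonempty (B-residually-nilpotent (powₛ 0) powₛ0∈B^) g-not-nilpotent

  B-countable : Countable B
  B-countable = Enumeration⇒Countable B STerm-enumeration

countable-elementarily-equivalent-not-residually-nilpotent :
    (lem : ∀ {a} → ExcludedMiddle a) → ∀ {c ℓ} (R : RingWithoutOne c ℓ) (g : RingWithoutOne.Carrier R)
  → (∀ k → let open RingWithoutOne R in ¬ (pow⁺ _*_ g k ≈ 0#))
  → Σ (RingWithoutOne c ℓ) λ B → Countable B × ¬ ResiduallyNilpotent B × ElemEquiv (reduct B) (reduct R)
countable-elementarily-equivalent-not-residually-nilpotent lem R g g-not-nilpotent =
  B , B-countable , B-not-residually-nilpotent g-not-nilpotent , B≡R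
  where open SkolemUltrapower lem R g

theorem9p9 : (lem : ∀ {a} → ExcludedMiddle a)
           → ∀ {c ℓ} (K : Field c ℓ) (n : ℕ) → n ≥ 1
           → Σ (RingWithoutOne c ℓ) λ B →
               Countable B × ¬ ResiduallyNilpotent B × ElemEquiv (reduct B) (A⁰ K n)
theorem9p9 lem K (suc m) _ =
  countable-elementarily-equivalent-not-residually-nilpotent lem ring
    (monomial (Field.1# K) (fzero ∷ [])) (generator-not-nilpotent fzero)
  where open FreeRing K (suc m)
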